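{- Let $q>1$ be a power of $2$, let $t$ be a positive integer, and let $a\in\mathbb{F}_q^*$. Then the function $c\mapsto ac^t$ is planar on $\mathbb{F}_q$ if and only if, for each $b\in\mathbb{F}_q^*$, the function $c\mapsto (c+1)^t+c^t+c\,a^{ -1}b^{t-2}$ is bijective on $\mathbb{F}_q$.
   Context: For $q$ a power of $2$, a function $F\colon\mathbb{F}_q\to\mathbb{F}_q$ is called planar if, for every $d\in\mathbb{F}_q^*$, the function $c\mapsto F(c+d)+F(c)+dc$ is a bijection on $\mathbb{F}_q$. -}

module Defs where

open import Level using (0ℓ)
open import Data.Nat using (ℕ; zero; suc; _∸_; _≤?_)
open import Data.Product using (_×_)
open import Relation.Nullary using (¬_; yes; no)
open import Relation.Binary.PropositionalEquality using (_≡_)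
open import Algebra.Structures using (IsCommutativeRing)
open import Function.Definitions using (Bijective)

record Field : Set₁ where
  infixl 6 _+_
  infixl 7 _*_
  field
    Carrier : Set
    _+_ _*_ : Carrier → Carrier → Carrier
    -_      : Carrier → Carrier
    0# 1#   : Carrier
    isCommutativeRing : IsCommutativeRing _≡_ _+_ _*_ -_ 0# 1#
    0≢1     : ¬ (0# ≡ 1#)
    inv     : (x : Carrier) → ¬ (x ≡ 0#) → Carrier
    inv-r   : (x : Carrier) (x≢0 : ¬ (x ≡ 0#)) → x * inv x x≢0 ≡ 1#

  infixr 8 _^ᶠ_
  _^ᶠ_ : Carrier → ℕ → Carrier
  x ^ᶠ zero  = 1#
  x ^ᶠ suc n = x * (x ^ᶠ n)

  -- x ^ (t - 2) as an integer power, for x ≠ 0 (negative exponents use the inverse)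
  pow-2 : (x : Carrier) → ¬ (x ≡ 0#) → ℕ → Carrier
  pow-2 x x≢0 t with 2 ≤? t
  ... | yes _ = x ^ᶠ (t ∸ 2)
  ... | no  _ = inv x x≢0 ^ᶠ (2 ∸ t)

  Bij : (Carrier → Carrier) → Set
  Bij f = Bijective {A = Carrier} {B = Carrier} _≡_ _≡_ f

  -- planarity (characteristic 2 form from the paper)
  Planar : (Carrier → Carrier) → Set
  Planar F = (d : Carrier) → ¬ (d ≡ 0#) → Bij (λ c → F (c + d) + F c + d * c)

-- For d ≠ 0 put b = d⁻¹. Substituting c = d x, the planarity difference
-- a (c + d)ᵗ + a cᵗ + d c becomes (a dᵗ) ((x + 1)ᵗ + xᵗ + x a⁻¹ b^(t−2)), because
-- dᵗ b^(t−2) = d² for every t ≥ 1. The two maps thus differ by invertible scalings of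
-- argument and value, so one is bijective iff the other is.
module Submission where

open import Level using (0ℓ)
open import Defs
open import Data.Nat using (ℕ; _≤_; _^_; zero; suc)
open import Data.Fin using (Fin)
open import Data.Product using (_,_)
open import Function.Base using (_∘_)
open import Function.Bundles using (_↔_; _⇔_; mk⇔; Equivalence)
open import Function.Consequences.Propositional using (inverseᵇ⇒bijective)
import Function.Construct.Composition as Composition
open import Relation.Nullary using (¬_)
open import Relation.Binary.PropositionalEquality
open import Algebra.Bundles using (CommutativeMonoid)
open import Algebra.Structures using (IsCommutativeRing)
import Algebra.Solver.CommutativeMonoid as CommutativeMonoidSolver

module FieldProperties (K : Field) where
  open Field K
  open IsCommutativeRing isCommutativeRing
    using (*-assoc; *-comm; *-identityˡ; *-identityʳ; zeroʳ; *-isCommutativeMonoid)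
  open ≡-Reasoning

  *-commutativeMonoid : CommutativeMonoid 0ℓ 0ℓ
  *-commutativeMonoid = record { isCommutativeMonoid = *-isCommutativeMonoid }

  open CommutativeMonoidSolver *-commutativeMonoid using (solve; _⊜_; _⊕_)

  inv-l : ∀ x (x≢0 : ¬ (x ≡ 0#)) → inv x x≢0 * x ≡ 1#
  inv-l x x≢0 = trans (*-comm _ _) (inv-r x x≢0)

  *-cancel-inverse : ∀ {u v} → u * v ≡ 1# → ∀ y → u * (v * y) ≡ y
  *-cancel-inverse {u} {v} uv≡1 y = begin
    u * (v * y) ≡⟨ *-assoc u v y ⟨
    (u * v) * y ≡⟨ cong (_* y) uv≡1 ⟩
    1# * y      ≡⟨ *-identityˡ y ⟩
    y           ∎

  *≡1⇒nonzeroˡ : ∀ {u v} → u * v ≡ 1# → ¬ (u ≡ 0#)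
  *≡1⇒nonzeroˡ {u} {v} uv≡1 refl = 0≢1 (trans (sym (trans (*-comm 0# v) (zeroʳ v))) uv≡1)

  inv-nonzero : ∀ x (x≢0 : ¬ (x ≡ 0#)) → ¬ (inv x x≢0 ≡ 0#)
  inv-nonzero x x≢0 = *≡1⇒nonzeroˡ (inv-l x x≢0)

  *-nonzero : ∀ {x y} → ¬ (x ≡ 0#) → ¬ (y ≡ 0#) → ¬ (x * y ≡ 0#)
  *-nonzero {x} {y} x≢0 y≢0 xy≡0 = y≢0 (begin
    y                  ≡⟨ *-cancel-inverse (inv-l x x≢0) y ⟨
    inv x x≢0 * (x * y) ≡⟨ cong (inv x x≢0 *_) xy≡0 ⟩
    inv x x≢0 * 0#      ≡⟨ zeroʳ _ ⟩
    0#                 ∎)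

  ^ᶠ-nonzero : ∀ {x} n → ¬ (x ≡ 0#) → ¬ (x ^ᶠ n ≡ 0#)
  ^ᶠ-nonzero zero    x≢0 1≡0 = 0≢1 (sym 1≡0)
  ^ᶠ-nonzero (suc n) x≢0     = *-nonzero x≢0 (^ᶠ-nonzero n x≢0)

  inv-unique : ∀ b (b≢0 : ¬ (b ≡ 0#)) {d} → b * d ≡ 1# → inv b b≢0 ≡ d
  inv-unique b b≢0 {d} bd≡1 = begin
    inv b b≢0           ≡⟨ *-identityʳ _ ⟨
    inv b b≢0 * 1#      ≡⟨ cong (inv b b≢0 *_) bd≡1 ⟨
    inv b b≢0 * (b * d) ≡⟨ *-cancel-inverse (inv-l b b≢0) d ⟩
    d                   ∎

  ^ᶠ-distrib-* : ∀ x y n → (x * y) ^ᶠ n ≡ x ^ᶠ n * y ^ᶠ n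
  ^ᶠ-distrib-* x y zero    = sym (*-identityˡ 1#)
  ^ᶠ-distrib-* x y (suc n) = begin
    (x * y) * (x * y) ^ᶠ n       ≡⟨ cong ((x * y) *_) (^ᶠ-distrib-* x y n) ⟩
    (x * y) * (x ^ᶠ n * y ^ᶠ n)   ≡⟨ solve 4 (λ x y p q → (x ⊕ y) ⊕ (p ⊕ q) ⊜ (x ⊕ p) ⊕ (y ⊕ q))
                                          refl x y (x ^ᶠ n) (y ^ᶠ n) ⟩
    (x * x ^ᶠ n) * (y * y ^ᶠ n)   ∎

  1^ᶠ : ∀ n → 1# ^ᶠ n ≡ 1#
  1^ᶠ zero    = refl
  1^ᶠ (suc n) = trans (*-identityˡ _) (1^ᶠ n)

  ^ᶠ*pow-2-of-inverse : ∀ t → 1 ≤ t → ∀ b (b≢0 : ¬ (b ≡ 0#)) {d} → b * d ≡ 1# →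
    d ^ᶠ t * pow-2 b b≢0 t ≡ d * d
  ^ᶠ*pow-2-of-inverse (suc zero) _ b b≢0 {d} bd≡1 =
    cong₂ _*_ (*-identityʳ d) (trans (*-identityʳ _) (inv-unique b b≢0 bd≡1))
  ^ᶠ*pow-2-of-inverse (suc (suc k)) _ b b≢0 {d} bd≡1 = begin
    (d * (d * d ^ᶠ k)) * b ^ᶠ k ≡⟨ solve 4 (λ d e p q → (d ⊕ (e ⊕ p)) ⊕ q ⊜ (d ⊕ e) ⊕ (p ⊕ q))
                                        refl d d (d ^ᶠ k) (b ^ᶠ k) ⟩
    (d * d) * (d ^ᶠ k * b ^ᶠ k) ≡⟨ cong ((d * d) *_) (^ᶠ-distrib-* d b k) ⟨
    (d * d) * (d * b) ^ᶠ k      ≡⟨ cong (λ u → (d * d) * u ^ᶠ k) (trans (*-comm d b) bd≡1) ⟩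
    (d * d) * 1# ^ᶠ k           ≡⟨ cong ((d * d) *_) (1^ᶠ k) ⟩
    (d * d) * 1#                ≡⟨ *-identityʳ _ ⟩
    d * d                       ∎

  Bij-resp-≗ : ∀ {f g : Carrier → Carrier} → (∀ x → f x ≡ g x) → Bij f → Bij g
  Bij-resp-≗ {f} {g} f≗g (f-inj , f-surj) = g-inj , g-surj
    where
    g-inj : ∀ {x y} → g x ≡ g y → x ≡ y
    g-inj gx≡gy = f-inj (trans (f≗g _) (trans gx≡gy (sym (f≗g _))))
    g-surj : ∀ y → _
    g-surj y with f-surj y
    ... | x , fz≡y = x , λ {z} z≡x → trans (sym (f≗g _)) (fz≡y z≡x)

  *-bijective : ∀ {u} → ¬ (u ≡ 0#) → Bij (u *_)
  *-bijective {u} u≢0 = inverseᵇ⇒bijective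
    ( (λ {x} y≡u⁻¹x → trans (cong (u *_) y≡u⁻¹x) (*-cancel-inverse (inv-r u u≢0) x))
    , (λ {x} y≡ux → trans (cong (inv u u≢0 *_) y≡ux) (*-cancel-inverse (inv-l u u≢0) x)) )

  Bij-rescale : ∀ {u v} {f g : Carrier → Carrier} → ¬ (u ≡ 0#) → ¬ (v ≡ 0#) →
    (∀ x → f x ≡ u * g (v * x)) → Bij g → Bij f
  Bij-rescale u≢0 v≢0 f≗ugv g-bij = Bij-resp-≗ (sym ∘ f≗ugv)
    (Composition.bijective _≡_ _≡_ _≡_
      (Composition.bijective _≡_ _≡_ _≡_ (*-bijective v≢0) g-bij) (*-bijective u≢0))

  Bij-rescale⇔ : ∀ {u v w} {f g : Carrier → Carrier} → ¬ (u ≡ 0#) → v * w ≡ 1# →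
    (∀ x → f (v * x) ≡ u * g x) → Bij f ⇔ Bij g
  Bij-rescale⇔ {u} {v} {w} {f} {g} u≢0 vw≡1 fv≗ug = mk⇔
    (Bij-rescale (inv-nonzero u u≢0) v≢0 λ x → begin
      g x                     ≡⟨ *-cancel-inverse (inv-l u u≢0) (g x) ⟨
      inv u u≢0 * (u * g x)   ≡⟨ cong (inv u u≢0 *_) (fv≗ug x) ⟨
      inv u u≢0 * f (v * x)   ∎)
    (Bij-rescale u≢0 w≢0 λ x → begin
      f x                     ≡⟨ cong f (*-cancel-inverse vw≡1 x) ⟨
      f (v * (w * x))         ≡⟨ fv≗ug (w * x) ⟩
      u * g (w * x)           ∎)
    where
    v≢0 = *≡1⇒nonzeroˡ vw≡1
    w≢0 = *≡1⇒nonzeroˡ (trans (*-comm w v) vw≡1)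

module PlanarRescaling (K : Field) (t : ℕ) (t≥1 : 1 ≤ t)
                       (a : Field.Carrier K) (a≢0 : ¬ (a ≡ Field.0# K)) where
  open Field K
  open FieldProperties K
  open IsCommutativeRing isCommutativeRing
    using (*-assoc; *-comm; *-identityˡ; *-identityʳ; distribˡ)
  open ≡-Reasoning
  open CommutativeMonoidSolver *-commutativeMonoid using (solve; _⊜_; _⊕_)

  difference : Carrier → Carrier → Carrier
  difference d c = a * (c + d) ^ᶠ t + a * c ^ᶠ t + d * c

  reduced : (b : Carrier) → ¬ (b ≡ 0#) → Carrier → Carrier
  reduced b b≢0 c = (c + 1#) ^ᶠ t + c ^ᶠ t + c * inv a a≢0 * pow-2 b b≢0 t

  module _ (b : Carrier) (b≢0 : ¬ (b ≡ 0#)) (d : Carrier) (bd≡1 : b * d ≡ 1#) where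

    scale : Carrier
    scale = a * d ^ᶠ t

    scale-^ᶠ : ∀ y → scale * y ^ᶠ t ≡ a * (d * y) ^ᶠ t
    scale-^ᶠ y = trans (*-assoc a _ _) (cong (a *_) (sym (^ᶠ-distrib-* d y t)))

    scale-linear : ∀ x → scale * (x * inv a a≢0 * pow-2 b b≢0 t) ≡ d * (d * x)
    scale-linear x = begin
      (a * D) * (x * a⁻¹ * P)   ≡⟨ solve 5 (λ a D x a⁻¹ P → (a ⊕ D) ⊕ ((x ⊕ a⁻¹) ⊕ P)
                                                      ⊜ (a ⊕ a⁻¹) ⊕ ((D ⊕ P) ⊕ x))
                                         refl a D x a⁻¹ P ⟩
      (a * a⁻¹) * ((D * P) * x) ≡⟨ cong₂ (λ u v → u * (v * x))
                                         (inv-r a a≢0) (^ᶠ*pow-2-of-inverse t t≥1 b b≢0 bd≡1) ⟩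
      1# * ((d * d) * x)        ≡⟨ trans (*-identityˡ _) (*-assoc d d x) ⟩
      d * (d * x)               ∎
      where
      D a⁻¹ P : Carrier
      D = d ^ᶠ t
      a⁻¹ = inv a a≢0
      P = pow-2 b b≢0 t

    difference-rescaled : ∀ x → difference d (d * x) ≡ scale * reduced b b≢0 x
    difference-rescaled x = sym (begin
      scale * ((x + 1#) ^ᶠ t + x ^ᶠ t + x * inv a a≢0 * pow-2 b b≢0 t)
        ≡⟨ distribˡ scale _ _ ⟩
      scale * ((x + 1#) ^ᶠ t + x ^ᶠ t) + scale * (x * inv a a≢0 * pow-2 b b≢0 t)
        ≡⟨ cong₂ _+_ (distribˡ scale _ _) (scale-linear x) ⟩
      scale * (x + 1#) ^ᶠ t + scale * x ^ᶠ t + d * (d * x)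
        ≡⟨ cong₂ (λ u v → u + v + d * (d * x)) (scale-^ᶠ (x + 1#)) (scale-^ᶠ x) ⟩
      a * (d * (x + 1#)) ^ᶠ t + a * (d * x) ^ᶠ t + d * (d * x)
        ≡⟨ cong (λ u → a * u ^ᶠ t + a * (d * x) ^ᶠ t + d * (d * x)) d[x+1]≡dx+d ⟩
      difference d (d * x) ∎)
      where
      d[x+1]≡dx+d : d * (x + 1#) ≡ d * x + d
      d[x+1]≡dx+d = trans (distribˡ d x 1#) (cong (d * x +_) (*-identityʳ d))

    Bij-difference⇔Bij-reduced : Bij (difference d) ⇔ Bij (reduced b b≢0)
    Bij-difference⇔Bij-reduced = Bij-rescale⇔ scale≢0 db≡1 difference-rescaled
      where
      db≡1 : d * b ≡ 1#
      db≡1 = trans (*-comm d b) bd≡1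
      scale≢0 : ¬ (scale ≡ 0#)
      scale≢0 = *-nonzero a≢0 (^ᶠ-nonzero t (*≡1⇒nonzeroˡ db≡1))

lemma2p1 : (K : Field) (n : ℕ) → 1 ≤ n → (Field.Carrier K ↔ Fin (2 ^ n)) →
    (t : ℕ) → 1 ≤ t → (a : Field.Carrier K) (a≢0 : ¬ (a ≡ Field.0# K)) →
    let open Field K in
    Planar (λ c → a * c ^ᶠ t) ⇔
      ((b : Carrier) (b≢0 : ¬ (b ≡ 0#)) →
        Bij (λ c → (c + 1#) ^ᶠ t + c ^ᶠ t + c * inv a a≢0 * pow-2 b b≢0 t))
lemma2p1 K _ _ _ t t≥1 a a≢0 = mk⇔ planar⇒reduced reduced⇒planar
  where
  open Field K
  open FieldProperties K using (inv-l; inv-nonzero)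
  open PlanarRescaling K t t≥1 a a≢0 using (difference; reduced; Bij-difference⇔Bij-reduced)

  planar⇒reduced : (∀ d → ¬ (d ≡ 0#) → Bij (difference d)) → ∀ b b≢0 → Bij (reduced b b≢0)
  planar⇒reduced planar b b≢0 =
    Equivalence.to (Bij-difference⇔Bij-reduced b b≢0 (inv b b≢0) (inv-r b b≢0))
      (planar (inv b b≢0) (inv-nonzero b b≢0))

  reduced⇒planar : (∀ b b≢0 → Bij (reduced b b≢0)) → ∀ d → ¬ (d ≡ 0#) → Bij (difference d)
  reduced⇒planar reduced-bij d d≢0 =
    Equivalence.from (Bij-difference⇔Bij-reduced (inv d d≢0) d⁻¹≢0 d (inv-l d d≢0))
      (reduced-bij (inv d d≢0) d⁻¹≢0)
    where
    d⁻¹≢0 : ¬ (inv d d≢0 ≡ 0#)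
    d⁻¹≢0 = inv-nonzero d d≢0
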